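{- Let $G$ be an acyclic graph on vertex set $[n+1]$. Then the root polytope $\mathcal{P}(G)$ is affinely equivalent to $\mathcal{S}(G)=p(\mathcal{F}_{\tilde G})$, which is a projection of the flow polytope $\mathcal{F}_{\tilde G}$. Indeed, $\mathcal{P}(G)=f(p(\mathcal{F}_{\tilde G}))$, and $f$ restricted to $\mathcal{S}(G)$ is an affine bijection onto $\mathcal{P}(G)$. Moreover, suppose the same sequence of reductions is performed starting from $G$, producing (i) a dissection $\mathcal{D}_1$ of $\mathcal{P}(G)$ into root polytopes $\mathcal{P}(H)$, and (ii) a dissection $\mathcal{D}_2$ of $\mathcal{F}_{\tilde G}$ into flow polytopes $\mathcal{F}_{\tilde H}$, where in each case a graph $G_0$ is replaced by $G_1$ and $G_2$ (with intersection corresponding to $G_3$). Then $\mathcal{D}_1$ is the image of $\mathcal{D}_2$ under $f\circ p$. In particular, $f(p(\mathcal{F}_{\tilde H}))=\mathcal{P}(H)$ for every graph $H$ arising in the process.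
   Context: Root polytopes: let $e_1,\dots,e_{n+1}$ be the standard basis of $\mathbb{R}^{n+1}$ and $\Phi^+=\{e_i-e_j:1\le i<j\le n+1\}$. For a graph $G$ on $[n+1]$ (edges written $(i,j)$ with $i<j$), let $\mathcal{C}(G)$ be the cone of nonnegative combinations of $\{e_i-e_j:(i,j)\in E(G)\}$. The root polytope is $\mathcal{P}(G)=\mathrm{ConvHull}(\{0\}\cup(\Phi^+\cap\mathcal{C}(G)))$. Flow polytopes: let $\tilde G$ be the graph on vertex set $[n+1]\cup\{s,t\}$ with edge set $E(G)\cup\{(s,i),(i,t):i\in[n+1]\}$, ordered by $s<1<\dots<n+1<t$, with edges directed from the smaller to the larger endpoint. The flow polytope $\mathcal{F}_{\tilde G}\subset\mathbb{R}^{E(\tilde G)}$ is the set of $f:E(\tilde G)\to\mathbb{R}_{\ge0}$ such that the total flow out of $s$ is $1$, the total flow into $t$ is $1$, and at each other vertex inflow equals outflow. Maps: with coordinate vectors $e_{(a,b)}$ of $\mathbb{R}^{E(\tilde G)}$, let $W$ be the span of $\{e_{(i,j)}:(i,j)\in E(G)\}$. Let $p$ be the orthogonal projection onto $W$, and let $f:W\to\mathbb{R}^{n+1}$ be the linear map with $f(e_{(i,j)})=e_i-e_j$. Reductions: given $G_0$ on $[n+1]$ with edges $(i,j),(j,k)$, $i<j<k$, define $E(G_1)=E(G_0)\setminus\{(j,k)\}\cup\{(i,k)\}$, $E(G_2)=E(G_0)\setminus\{(i,j)\}\cup\{(i,k)\}$, $E(G_3)=E(G_0)\setminus\{(i,j),(j,k)\}\cup\{(i,k)\}$.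 For acyclic $G_0$ one has $\mathcal{P}(G_0)=\mathcal{P}(G_1)\cup\mathcal{P}(G_2)$ with $\mathcal{P}(G_1)\cap\mathcal{P}(G_2)=\mathcal{P}(G_3)$ (same dimension for the first three, one less for the last). Analogously, $\mathcal{F}_{\tilde G_0}=\mathcal{F}_{\tilde G_1}\cup\mathcal{F}_{\tilde G_2}$ with intersection $\mathcal{F}_{\tilde G_3}$. Repeating this yields the dissections.
   Formalization: The polytopes $\mathcal{P}(G)$, $\mathcal{F}_{\tilde G}$ and $\mathcal{S}(G)$ consist of rational points, with rational convex-combination coefficients, in ℚ^(n+1) and ℚ^(E(G̃)) instead of ℝ^(n+1) and ℝ^(E(G̃)). -}

module Defs where

open import Data.Nat using (ℕ; zero; suc)
open import Data.Fin using (Fin; zero; suc)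
open import Data.Fin.Properties using (_≟_; _<?_)
open import Data.Bool using (Bool; true; false; _∧_; _∨_; not; if_then_else_; T)
open import Data.Rational using (ℚ; 0ℚ; 1ℚ; _+_; _-_; _*_; _≤_)
open import Data.List using (List; []; _∷_; _∷ʳ_; foldr)
open import Data.List.Relation.Unary.All using (All)
open import Data.List.Relation.Unary.Unique.Propositional using (Unique)
open import Data.List.Relation.Unary.Linked using (Linked)
open import Data.Product using (Σ; ∃; _×_; _,_; proj₁; proj₂)
open import Data.Sum using (_⊎_)
open import Relation.Nullary using (¬_; does)
open import Relation.Binary.PropositionalEquality using (_≡_)

-- Linear algebra over ℚ (ambient field; all polytopes here are rational)

Σ[_] : (k : ℕ) → (Fin k → ℚ) → ℚ
Σ[ zero ] g = 0ℚ
Σ[ suc k ] g = g zero + Σ[ k ] (λ i → g (suc i))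

Pt : ℕ → Set
Pt m = Fin m → ℚ

_≋_ : {m : ℕ} → Pt m → Pt m → Set
x ≋ y = ∀ i → x i ≡ y i

0v : {m : ℕ} → Pt m
0v _ = 0ℚ

_⊕_ : {m : ℕ} → Pt m → Pt m → Pt m
(x ⊕ y) i = x i + y i

_⊙_ : {m : ℕ} → ℚ → Pt m → Pt m
(c ⊙ x) i = c * x i

Σv[_] : {m : ℕ} (k : ℕ) → (Fin k → Pt m) → Pt m
Σv[ k ] g i = Σ[ k ] (λ a → g a i)

e : {m : ℕ} → Fin m → Pt m
e i j = if does (i ≟ j) then 1ℚ else 0ℚ

root : {m : ℕ} → Fin m → Fin m → Pt m
root i j k = e i k - e j k

ConvHull : {m : ℕ} → (Pt m → Set) → Pt m → Set
ConvHull {m} S y =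
  Σ (List (ℚ × Pt m)) λ ws →
    All (λ w → (0ℚ ≤ proj₁ w) × S (proj₂ w)) ws
    × foldr (λ w acc → proj₁ w + acc) 0ℚ ws ≡ 1ℚ
    × y ≋ foldr (λ w acc → (proj₁ w ⊙ proj₂ w) ⊕ acc) 0v ws

-- Graphs on [m] (here m = n+1), vertices Fin m.
-- A graph is given by a Boolean edge indicator; only pairs (i,j) with
-- i < j are edges, i.e. E(G) = {(i,j) : i < j, G i j ≡ true}.

Graph : ℕ → Set
Graph m = Fin m → Fin m → Bool

edgeB : {m : ℕ} → Graph m → Fin m → Fin m → Bool
edgeB G i j = does (i <? j) ∧ G i j

IsEdge : {m : ℕ} → Graph m → Fin m → Fin m → Set
IsEdge G i j = T (edgeB G i j)

Adj : {m : ℕ} → Graph m → Fin m → Fin m → Set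
Adj G a b = IsEdge G a b ⊎ IsEdge G b a

Acyclic : {m : ℕ} → Graph m → Set
Acyclic {m} G =
  ¬ (Σ (Fin m) λ a → Σ (Fin m) λ b → Σ (Fin m) λ c → Σ (List (Fin m)) λ rest →
       Unique (a ∷ b ∷ c ∷ rest) × Linked (Adj G) ((a ∷ b ∷ c ∷ rest) ∷ʳ a))

edgeComb : {m : ℕ} → Graph m → (Fin m → Fin m → ℚ) → Pt m
edgeComb {m} G c =
  Σv[ m ] λ i → Σv[ m ] λ j →
    if edgeB G i j then c i j ⊙ root i j else 0v

Cone : {m : ℕ} → Graph m → Pt m → Set
Cone {m} G y =
  Σ (Fin m → Fin m → ℚ) λ c →
    (∀ i j → IsEdge G i j → 0ℚ ≤ c i j) × y ≋ edgeComb G c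

RootPolyGens : {m : ℕ} → Graph m → Pt m → Set
RootPolyGens {m} G y =
  y ≋ 0v ⊎ (Σ (Fin m) λ i → Σ (Fin m) λ j →
              (i Data.Fin.< j) × Cone G (root i j) × y ≋ root i j)

RootPolytope : {m : ℕ} → Graph m → Pt m → Set
RootPolytope G = ConvHull (RootPolyGens G)

-- Flow polytope of G̃ (vertices s < 1 < ... < m < t).
-- A point of ℝ^{E(G̃)} consists of: values on the edges of G
-- (a function Fin m → Fin m → ℚ, only its values on E(G) are coordinates),
-- values on the edges (s,i), and values on the edges (i,t).

W : ℕ → Set
W m = Fin m → Fin m → ℚ

_≈W[_]_ : {m : ℕ} → W m → Graph m → W m → Set
x ≈W[ G ] y = ∀ i j → IsEdge G i j → x i j ≡ y i j

record FlowPt (m : ℕ) : Set where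
  constructor flowPt
  field
    inner  : W m
    source : Fin m → ℚ
    sink   : Fin m → ℚ
open FlowPt public

edgeVal : {m : ℕ} → Graph m → W m → Fin m → Fin m → ℚ
edgeVal G x i j = if edgeB G i j then x i j else 0ℚ

FlowPolytope : {m : ℕ} → Graph m → FlowPt m → Set
FlowPolytope {m} G φ =
  (∀ i j → IsEdge G i j → 0ℚ ≤ inner φ i j)
  × (∀ i → 0ℚ ≤ source φ i)
  × (∀ i → 0ℚ ≤ sink φ i)
  × Σ[ m ] (source φ) ≡ 1ℚ
  × Σ[ m ] (sink φ) ≡ 1ℚ
  × (∀ v → source φ v + Σ[ m ] (λ i → edgeVal G (inner φ) i v)
         ≡ sink φ v + Σ[ m ] (λ j → edgeVal G (inner φ) v j))

proj : {m : ℕ} → FlowPt m → W m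
proj φ = inner φ

fmap : {m : ℕ} → Graph m → W m → Pt m
fmap G x = edgeComb G x

eqB : {m : ℕ} → Fin m → Fin m → Bool
eqB a b = does (a ≟ b)

red₁ red₂ red₃ : {m : ℕ} → Graph m → Fin m → Fin m → Fin m → Graph m
red₁ G i j k a b = (G a b ∧ not (eqB a j ∧ eqB b k)) ∨ (eqB a i ∧ eqB b k)
red₂ G i j k a b = (G a b ∧ not (eqB a i ∧ eqB b j)) ∨ (eqB a i ∧ eqB b k)
red₃ G i j k a b =
  (G a b ∧ not (eqB a i ∧ eqB b j) ∧ not (eqB a j ∧ eqB b k)) ∨ (eqB a i ∧ eqB b k)

-- H arises from G in a sequence of reductions (every graph produced
-- in the process, including G itself and the intersection graphs G₃)
data Arises {m : ℕ} (G : Graph m) : Graph m → Set where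
  start : Arises G G
  step₁ : ∀ {G₀} i j k → Arises G G₀ → IsEdge G₀ i j → IsEdge G₀ j k →
          Arises G (red₁ G₀ i j k)
  step₂ : ∀ {G₀} i j k → Arises G G₀ → IsEdge G₀ i j → IsEdge G₀ j k →
          Arises G (red₂ G₀ i j k)
  step₃ : ∀ {G₀} i j k → Arises G G₀ → IsEdge G₀ i j → IsEdge G₀ j k →
          Arises G (red₃ G₀ i j k)

-- For a point φ of F_G̃, f(p(φ)) = Σ φ(i,j) (e_i − e_j) is the divergence of the inner flow, which
-- by conservation equals Σ_v (φ(s,v) − φ(v,t)) e_v. A generator e_i − e_j ∈ C(G) of P(G) is the image
-- of the flow entering at i and leaving at j whose inner part is a cone witness, and flows are closed
-- under nonnegative combinations; hence P(G) ⊆ f(p(F_G̃)). Conversely, rerouting the flow through each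
-- vertex k in turn (turning paths i → k → j into direct pairs (i, j), with e_i − e_j still in C(G))
-- produces a flow along positive roots of C(G) in which every vertex is a pure source or a pure sink;
-- its total weight is at most 1, which writes f(p(φ)) as a convex combination of generators.
-- Neither inclusion uses acyclicity, so P(H) = f(p(F_H̃)) for every graph H whatsoever. Acyclicity
-- is needed only for injectivity: two points of W with the same image differ by a circulation
-- supported on the edges of a forest, and such a circulation vanishes.

module Submission where

open import Defs
open import Data.Bool using (Bool; true; false; T; T?; _∧_; if_then_else_)
open import Data.Empty using (⊥; ⊥-elim)
open import Data.Fin using (Fin; zero; suc) renaming (_<_ to _<ᶠ_)
import Data.Fin.Properties as Fin
open import Data.List using (List; []; _∷_; _++_; _∷ʳ_; foldr; allFin; length; lookup)
open import Data.List.Membership.Propositional.Properties using (∈-allFin; ∈-lookup; ∈-∃++)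
import Data.List.Relation.Unary.Any as Any
open import Data.List.Relation.Unary.AllPairs using (AllPairs; []; _∷_)
import Data.List.Relation.Unary.Linked as Linked
open Linked using (Linked; [-]; _∷_)
open import Data.List.Relation.Unary.Unique.Propositional using (Unique)
import Data.List.Relation.Unary.All as All
open All using (All; []; _∷_)
import Data.List.Relation.Unary.All.Properties as Allₚ
open import Data.Nat using (ℕ; zero; suc)
import Data.Nat as ℕ
import Data.Nat.Properties as ℕ
open import Data.Product using (Σ; _×_; _,_; proj₁; proj₂)
open import Data.Rational
  using (ℚ; 0ℚ; 1ℚ; _+_; _-_; _*_; -_; 1/_; _≤_; NonZero; Positive; NonNegative; ≢-nonZero; nonNegative)
import Data.Rational.Properties as ℚ
open import Data.Rational.Solver using (module +-*-Solver)
open +-*-Solver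
open import Data.Sum using (_⊎_; inj₁; inj₂)
open import Function.Bundles using (_⇔_; mk⇔)
open import Relation.Nullary using (¬_; Dec; yes; no; does)
open import Relation.Nullary.Decidable using (¬?; _×-dec_; _⊎-dec_; decidable-stable)
open import Relation.Binary.PropositionalEquality
  using (_≡_; _≢_; refl; sym; trans; cong; cong₂; subst; subst₂; module ≡-Reasoning)

nonNeg-+ : ∀ {p q} → 0ℚ ≤ p → 0ℚ ≤ q → 0ℚ ≤ p + q
nonNeg-+ {p} {q} 0≤p 0≤q = subst (_≤ p + q) (ℚ.+-identityˡ 0ℚ) (ℚ.+-mono-≤ 0≤p 0≤q)

nonNeg-* : ∀ {p q} → 0ℚ ≤ p → 0ℚ ≤ q → 0ℚ ≤ p * q
nonNeg-* {p} {q} 0≤p 0≤q =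
  ℚ.nonNegative⁻¹ _ {{ℚ.nonNeg*nonNeg⇒nonNeg p {{nonNegative 0≤p}} q {{nonNegative 0≤q}}}}

0≤1 : 0ℚ ≤ 1ℚ
0≤1 = ℚ.nonNegative⁻¹ 1ℚ

p≤q⇒0≤q-p : ∀ {p q} → p ≤ q → 0ℚ ≤ q - p
p≤q⇒0≤q-p {p} {q} p≤q = subst (_≤ q - p) (ℚ.+-inverseʳ p) (ℚ.+-monoˡ-≤ (- p) p≤q)

0≤q-p⇒p≤q : ∀ {p q} → 0ℚ ≤ q - p → p ≤ q
0≤q-p⇒p≤q {p} {q} 0≤q-p =
  subst₂ _≤_ (ℚ.+-identityˡ p) (solve 2 (λ p q → (q :- p) :+ p := q) refl p q) (ℚ.+-monoˡ-≤ p 0≤q-p)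

p-q≡0⇒p≡q : ∀ p q → p - q ≡ 0ℚ → p ≡ q
p-q≡0⇒p≡q p q p-q≡0 =
  trans (solve 2 (λ p q → p := (p :- q) :+ q) refl p q) (trans (cong (_+ q) p-q≡0) (ℚ.+-identityˡ q))

e-diag : ∀ {m} (i : Fin m) → e i i ≡ 1ℚ
e-diag i with i Fin.≟ i
... | yes _ = refl
... | no i≢i = ⊥-elim (i≢i refl)

e-offDiag : ∀ {m} {i j : Fin m} → i ≢ j → e i j ≡ 0ℚ
e-offDiag {i = i} {j} i≢j with i Fin.≟ j
... | yes i≡j = ⊥-elim (i≢j i≡j)
... | no _ = refl

e-nonNeg : ∀ {m} (i j : Fin m) → 0ℚ ≤ e i j
e-nonNeg i j with i Fin.≟ j
... | yes _ = 0≤1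
... | no _ = ℚ.≤-refl

Σ-cong : ∀ k {f g : Fin k → ℚ} → (∀ i → f i ≡ g i) → Σ[ k ] f ≡ Σ[ k ] g
Σ-cong zero f≡g = refl
Σ-cong (suc k) f≡g = cong₂ _+_ (f≡g zero) (Σ-cong k (λ i → f≡g (suc i)))

Σ-zero : ∀ k → Σ[ k ] (λ _ → 0ℚ) ≡ 0ℚ
Σ-zero zero = refl
Σ-zero (suc k) = trans (ℚ.+-identityˡ _) (Σ-zero k)

Σ-distrib-+ : ∀ k (f g : Fin k → ℚ) → Σ[ k ] (λ i → f i + g i) ≡ Σ[ k ] f + Σ[ k ] g
Σ-distrib-+ zero f g = refl
Σ-distrib-+ (suc k) f g =
  trans (cong (f zero + g zero +_) (Σ-distrib-+ k (λ i → f (suc i)) (λ i → g (suc i))))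
        (solve 4 (λ x y F G → (x :+ y) :+ (F :+ G) := (x :+ F) :+ (y :+ G))
               refl (f zero) (g zero) (Σ[ k ] (λ i → f (suc i))) (Σ[ k ] (λ i → g (suc i))))

Σ-distribˡ-* : ∀ k (c : ℚ) (f : Fin k → ℚ) → Σ[ k ] (λ i → c * f i) ≡ c * Σ[ k ] f
Σ-distribˡ-* zero c f = sym (ℚ.*-zeroʳ c)
Σ-distribˡ-* (suc k) c f =
  trans (cong (c * f zero +_) (Σ-distribˡ-* k c (λ i → f (suc i)))) (sym (ℚ.*-distribˡ-+ c (f zero) _))

Σ-distrib-neg : ∀ k (f : Fin k → ℚ) → Σ[ k ] (λ i → - f i) ≡ - Σ[ k ] f
Σ-distrib-neg zero f = refl
Σ-distrib-neg (suc k) f =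
  trans (cong (- f zero +_) (Σ-distrib-neg k (λ i → f (suc i)))) (sym (ℚ.neg-distrib-+ (f zero) _))

Σ-distrib-- : ∀ k (f g : Fin k → ℚ) → Σ[ k ] (λ i → f i - g i) ≡ Σ[ k ] f - Σ[ k ] g
Σ-distrib-- k f g = trans (Σ-distrib-+ k f (λ i → - g i)) (cong (Σ[ k ] f +_) (Σ-distrib-neg k g))

Σ-linear : ∀ k (c : ℚ) (f g : Fin k → ℚ) → Σ[ k ] (λ i → c * f i + g i) ≡ c * Σ[ k ] f + Σ[ k ] g
Σ-linear k c f g = trans (Σ-distrib-+ k _ g) (cong (_+ Σ[ k ] g) (Σ-distribˡ-* k c f))

Σ-nonNeg : ∀ k {f : Fin k → ℚ} → (∀ i → 0ℚ ≤ f i) → 0ℚ ≤ Σ[ k ] f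
Σ-nonNeg zero _ = ℚ.≤-refl
Σ-nonNeg (suc k) 0≤f = nonNeg-+ (0≤f zero) (Σ-nonNeg k (λ i → 0≤f (suc i)))

Σ-mono-≤ : ∀ k {f g : Fin k → ℚ} → (∀ i → f i ≤ g i) → Σ[ k ] f ≤ Σ[ k ] g
Σ-mono-≤ zero _ = ℚ.≤-refl
Σ-mono-≤ (suc k) f≤g = ℚ.+-mono-≤ (f≤g zero) (Σ-mono-≤ k (λ i → f≤g (suc i)))

Σ-single : ∀ k (f : Fin k → ℚ) (p : Fin k) → (∀ i → i ≢ p → f i ≡ 0ℚ) → Σ[ k ] f ≡ f p
Σ-single (suc k) f zero f≡0 =
  trans (cong (f zero +_) (trans (Σ-cong k (λ i → f≡0 (suc i) λ ())) (Σ-zero k)))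
        (ℚ.+-identityʳ (f zero))
Σ-single (suc k) f (suc p) f≡0 =
  trans (cong₂ _+_ (f≡0 zero λ ()) (Σ-single k (λ i → f (suc i)) p
                                      (λ i i≢p → f≡0 (suc i) (λ eq → i≢p (Fin.suc-injective eq)))))
        (ℚ.+-identityˡ (f (suc p)))

Σ-e-* : ∀ k (v : Fin k) (g : Fin k → ℚ) → Σ[ k ] (λ i → e i v * g i) ≡ g v
Σ-e-* k v g =
  trans (Σ-single k _ v (λ i i≢v → trans (cong (_* g i) (e-offDiag i≢v)) (ℚ.*-zeroˡ (g i))))
        (trans (cong (_* g v) (e-diag v)) (ℚ.*-identityˡ (g v)))

Σ-e : ∀ {m} (i : Fin m) → Σ[ m ] (e i) ≡ 1ℚ
Σ-e {m} i = trans (Σ-single m (e i) i (λ j j≢i → e-offDiag (λ i≡j → j≢i (sym i≡j)))) (e-diag i)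

-- Divergence of a matrix viewed as a flow on the complete graph

Mat : ℕ → Set
Mat m = Fin m → Fin m → ℚ

outflow inflow divergence : ∀ {m} → Mat m → Fin m → ℚ
outflow {m} M v = Σ[ m ] (M v)
inflow {m} M v = Σ[ m ] (λ i → M i v)
divergence M v = outflow M v - inflow M v

divergence-cong : ∀ {m} {M N : Mat m} → (∀ i j → M i j ≡ N i j) →
  ∀ v → divergence M v ≡ divergence N v
divergence-cong {m} M≡N v = cong₂ _-_ (Σ-cong m (M≡N v)) (Σ-cong m (λ i → M≡N i v))

divergence-linear : ∀ {m} (c : ℚ) (M N : Mat m) v →
  divergence (λ i j → c * M i j + N i j) v ≡ c * divergence M v + divergence N v
divergence-linear {m} c M N v =
  trans (cong₂ _-_ (Σ-linear m c (M v) (N v)) (Σ-linear m c (λ i → M i v) (λ i → N i v)))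
        (solve 5 (λ c a b x y → (c :* a :+ b) :- (c :* x :+ y) := c :* (a :- x) :+ (b :- y))
               refl c (outflow M v) (outflow N v) (inflow M v) (inflow N v))

Σ-*-root : ∀ {m} (M : Mat m) v → Σ[ m ] (λ i → Σ[ m ] (λ j → M i j * root i j v)) ≡ divergence M v
Σ-*-root {m} M v = begin
    Σ[ m ] (λ i → Σ[ m ] (λ j → M i j * (e i v - e j v)))
  ≡⟨ Σ-cong m (λ i → Σ-cong m (λ j → expand (M i j) (e i v) (e j v))) ⟩
    Σ[ m ] (λ i → Σ[ m ] (λ j → e i v * M i j - e j v * M i j))
  ≡⟨ Σ-cong m (λ i → trans (Σ-distrib-- m _ _)
                           (cong₂ _-_ (Σ-distribˡ-* m (e i v) (M i)) (Σ-e-* m v (M i)))) ⟩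
    Σ[ m ] (λ i → e i v * outflow M i - M i v)
  ≡⟨ trans (Σ-distrib-- m _ _) (cong (_- inflow M v) (Σ-e-* m v (outflow M))) ⟩
    divergence M v ∎
  where
  open ≡-Reasoning
  expand : ∀ x a b → x * (a - b) ≡ a * x - b * x
  expand = solve 3 (λ x a b → x :* (a :- b) := a :* x :- b :* x) refl

if-⊙ : ∀ {m} (b : Bool) (c : ℚ) (y : Pt m) v →
  (if b then c ⊙ y else 0v) v ≡ (if b then c else 0ℚ) * y v
if-⊙ true c y v = refl
if-⊙ false c y v = sym (ℚ.*-zeroˡ (y v))

fmap≡divergence : ∀ {m} (G : Graph m) (x : W m) v → fmap G x v ≡ divergence (edgeVal G x) v
fmap≡divergence {m} G x v =
  trans (Σ-cong m (λ i → Σ-cong m (λ j → if-⊙ (edgeB G i j) (x i j) (root i j) v)))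
        (Σ-*-root (edgeVal G x) v)

edgeVal-zero : ∀ {m} (G : Graph m) i j → edgeVal G (λ _ _ → 0ℚ) i j ≡ 0ℚ
edgeVal-zero G i j with edgeB G i j
... | true = refl
... | false = refl

edgeVal-linear : ∀ {m} (G : Graph m) (c : ℚ) (x y : W m) i j →
  edgeVal G (λ a b → c * x a b + y a b) i j ≡ c * edgeVal G x i j + edgeVal G y i j
edgeVal-linear G c x y i j with edgeB G i j
... | true = refl
... | false = sym (trans (ℚ.+-identityʳ (c * 0ℚ)) (ℚ.*-zeroʳ c))

divergence-edgeVal-zero : ∀ {m} (G : Graph m) v → divergence (edgeVal G (λ _ _ → 0ℚ)) v ≡ 0ℚ
divergence-edgeVal-zero {m} G v =
  trans (divergence-cong (edgeVal-zero G) v)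
        (trans (cong₂ _-_ (Σ-zero m) (Σ-zero m)) (ℚ.+-inverseʳ 0ℚ))

-- Flows of arbitrary value; FlowPolytope is the case of value 1

net : ∀ {m} → FlowPt m → Pt m
net φ v = source φ v - sink φ v

record Flow {m : ℕ} (G : Graph m) (value : ℚ) (φ : FlowPt m) : Set where
  field
    inner-nonNeg  : ∀ i j → IsEdge G i j → 0ℚ ≤ inner φ i j
    source-nonNeg : ∀ i → 0ℚ ≤ source φ i
    sink-nonNeg   : ∀ i → 0ℚ ≤ sink φ i
    source-total  : Σ[ m ] (source φ) ≡ value
    sink-total    : Σ[ m ] (sink φ) ≡ value
    conservation  : ∀ v → divergence (edgeVal G (inner φ)) v ≡ net φ v
open Flow

fmap≋net : ∀ {m} {G : Graph m} {T φ} → Flow G T φ → fmap G (proj φ) ≋ net φ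
fmap≋net {G = G} {φ = φ} F v = trans (fmap≡divergence G (inner φ) v) (conservation F v)

balance⇒divergence : ∀ s i t o → s + i ≡ t + o → o - i ≡ s - t
balance⇒divergence s i t o eq = begin
    o - i              ≡⟨ solve 3 (λ o i t → o :- i := (t :+ o) :- t :- i) refl o i t ⟩
    (t + o) - t - i    ≡⟨ cong (λ z → z - t - i) (sym eq) ⟩
    (s + i) - t - i    ≡⟨ solve 3 (λ s i t → (s :+ i) :- t :- i := s :- t) refl s i t ⟩
    s - t              ∎
  where open ≡-Reasoning

divergence⇒balance : ∀ s i t o → o - i ≡ s - t → s + i ≡ t + o
divergence⇒balance s i t o eq = begin
    s + i              ≡⟨ solve 3 (λ s i t → s :+ i := t :+ ((s :- t) :+ i)) refl s i t ⟩
    t + ((s - t) + i)  ≡⟨ cong (λ z → t + (z + i)) (sym eq) ⟩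
    t + ((o - i) + i)  ≡⟨ solve 3 (λ o i t → t :+ ((o :- i) :+ i) := t :+ o) refl o i t ⟩
    t + o              ∎
  where open ≡-Reasoning

FlowPolytope⇒Flow : ∀ {m} {G : Graph m} {φ} → FlowPolytope G φ → Flow G 1ℚ φ
FlowPolytope⇒Flow {G = G} {φ} (nnI , nnS , nnT , sumS , sumT , balance) = record
  { inner-nonNeg = nnI ; source-nonNeg = nnS ; sink-nonNeg = nnT
  ; source-total = sumS ; sink-total = sumT
  ; conservation = λ v → balance⇒divergence (source φ v) (inflow (edgeVal G (inner φ)) v)
                                            (sink φ v) (outflow (edgeVal G (inner φ)) v) (balance v) }

Flow⇒FlowPolytope : ∀ {m} {G : Graph m} {φ} → Flow G 1ℚ φ → FlowPolytope G φ
Flow⇒FlowPolytope {G = G} {φ} F =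
  inner-nonNeg F , source-nonNeg F , sink-nonNeg F , source-total F , sink-total F ,
  λ v → divergence⇒balance (source φ v) (inflow (edgeVal G (inner φ)) v)
                           (sink φ v) (outflow (edgeVal G (inner φ)) v) (conservation F v)

zeroFlow : ∀ {m} → FlowPt m
zeroFlow = flowPt (λ _ _ → 0ℚ) (λ _ → 0ℚ) (λ _ → 0ℚ)

Flow-zero : ∀ {m} (G : Graph m) → Flow G 0ℚ zeroFlow
Flow-zero {m} G = record
  { inner-nonNeg = λ _ _ _ → ℚ.≤-refl
  ; source-nonNeg = λ _ → ℚ.≤-refl ; sink-nonNeg = λ _ → ℚ.≤-refl
  ; source-total = Σ-zero m ; sink-total = Σ-zero m
  ; conservation = λ v → trans (divergence-edgeVal-zero G v) (sym (ℚ.+-inverseʳ 0ℚ)) }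

scaleAdd : ∀ {m} → ℚ → FlowPt m → FlowPt m → FlowPt m
scaleAdd c φ ψ = flowPt (λ i j → c * inner φ i j + inner ψ i j)
                        (λ i → c * source φ i + source ψ i)
                        (λ i → c * sink φ i + sink ψ i)

net-scaleAdd : ∀ {m} c (φ ψ : FlowPt m) v → net (scaleAdd c φ ψ) v ≡ c * net φ v + net ψ v
net-scaleAdd c φ ψ v =
  solve 5 (λ c s t s' t' → (c :* s :+ s') :- (c :* t :+ t') := c :* (s :- t) :+ (s' :- t'))
        refl c (source φ v) (sink φ v) (source ψ v) (sink ψ v)

Flow-scaleAdd : ∀ {m} {G : Graph m} {T T' φ ψ} (c : ℚ) → 0ℚ ≤ c →
  Flow G T φ → Flow G T' ψ → Flow G (c * T + T') (scaleAdd c φ ψ)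
Flow-scaleAdd {m} {G} {φ = φ} {ψ} c 0≤c F F' = record
  { inner-nonNeg = λ i j ij →
      nonNeg-+ (nonNeg-* 0≤c (inner-nonNeg F i j ij)) (inner-nonNeg F' i j ij)
  ; source-nonNeg = λ i → nonNeg-+ (nonNeg-* 0≤c (source-nonNeg F i)) (source-nonNeg F' i)
  ; sink-nonNeg = λ i → nonNeg-+ (nonNeg-* 0≤c (sink-nonNeg F i)) (sink-nonNeg F' i)
  ; source-total =
      trans (Σ-linear m c _ _) (cong₂ (λ a b → c * a + b) (source-total F) (source-total F'))
  ; sink-total =
      trans (Σ-linear m c _ _) (cong₂ (λ a b → c * a + b) (sink-total F) (sink-total F'))
  ; conservation = λ v → begin
      divergence (edgeVal G (λ i j → c * inner φ i j + inner ψ i j)) v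
    ≡⟨ divergence-cong (edgeVal-linear G c (inner φ) (inner ψ)) v ⟩
      divergence (λ i j → c * edgeVal G (inner φ) i j + edgeVal G (inner ψ) i j) v
    ≡⟨ divergence-linear c (edgeVal G (inner φ)) (edgeVal G (inner ψ)) v ⟩
      c * divergence (edgeVal G (inner φ)) v + divergence (edgeVal G (inner ψ)) v
    ≡⟨ cong₂ (λ a b → c * a + b) (conservation F v) (conservation F' v) ⟩
      c * net φ v + net ψ v
    ≡⟨ sym (net-scaleAdd c φ ψ v) ⟩
      net (scaleAdd c φ ψ) v ∎ }
  where open ≡-Reasoning

-- Nonnegative combinations; ConvHull S is the case of total weight 1

weightSum : ∀ {m} → List (ℚ × Pt m) → ℚ
weightSum = foldr (λ w acc → proj₁ w + acc) 0ℚ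

pointSum : ∀ {m} → List (ℚ × Pt m) → Pt m
pointSum = foldr (λ w acc → (proj₁ w ⊙ proj₂ w) ⊕ acc) 0v

Combination : ∀ {m} → (Pt m → Set) → ℚ → Pt m → Set
Combination S T y =
  Σ _ λ ws → All (λ w → (0ℚ ≤ proj₁ w) × S (proj₂ w)) ws × weightSum ws ≡ T × y ≋ pointSum ws

weightSum-++ : ∀ {m} (ws vs : List (ℚ × Pt m)) → weightSum (ws ++ vs) ≡ weightSum ws + weightSum vs
weightSum-++ [] vs = sym (ℚ.+-identityˡ _)
weightSum-++ (w ∷ ws) vs =
  trans (cong (proj₁ w +_) (weightSum-++ ws vs)) (sym (ℚ.+-assoc (proj₁ w) _ _))

pointSum-++ : ∀ {m} (ws vs : List (ℚ × Pt m)) → pointSum (ws ++ vs) ≋ (pointSum ws ⊕ pointSum vs)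
pointSum-++ [] vs i = sym (ℚ.+-identityˡ _)
pointSum-++ (w ∷ ws) vs i =
  trans (cong (proj₁ w * proj₂ w i +_) (pointSum-++ ws vs i))
        (sym (ℚ.+-assoc (proj₁ w * proj₂ w i) _ _))

Combination-cong : ∀ {m} {S : Pt m → Set} {T T' y y'} → T ≡ T' → y ≋ y' →
  Combination S T y → Combination S T' y'
Combination-cong T≡T' y≋y' (ws , ok , total , y≋) =
  ws , ok , trans total T≡T' , λ i → trans (sym (y≋y' i)) (y≋ i)

Combination-zero : ∀ {m} {S : Pt m → Set} → Combination S 0ℚ 0v
Combination-zero = [] , [] , refl , λ _ → refl

Combination-single : ∀ {m} {S : Pt m → Set} {c y} → 0ℚ ≤ c → S y → Combination S c (c ⊙ y)
Combination-single {c = c} {y} 0≤c Sy =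
  (c , y) ∷ [] , (0≤c , Sy) ∷ [] , ℚ.+-identityʳ c , λ i → sym (ℚ.+-identityʳ (c * y i))

Combination-+ : ∀ {m} {S : Pt m → Set} {T T' y y'} →
  Combination S T y → Combination S T' y' → Combination S (T + T') (y ⊕ y')
Combination-+ (ws , ok , total , y≋) (vs , ok' , total' , y'≋) =
  ws ++ vs , Allₚ.++⁺ ok ok' ,
  trans (weightSum-++ ws vs) (cong₂ _+_ total total') ,
  λ i → trans (cong₂ _+_ (y≋ i) (y'≋ i)) (sym (pointSum-++ ws vs i))

Combination-Σ : ∀ {m} {S : Pt m → Set} k {T : Fin k → ℚ} {y : Fin k → Pt m} →
  (∀ a → Combination S (T a) (y a)) → Combination S (Σ[ k ] T) (Σv[ k ] y)
Combination-Σ zero _ = Combination-zero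
Combination-Σ (suc k) C = Combination-+ (C zero) (Combination-Σ k (λ a → C (suc a)))

-- P(G) ⊆ f(p(F_G̃))

generatorFlow : ∀ {n} (G : Graph (suc n)) {y} → RootPolyGens G y →
  Σ (FlowPt (suc n)) λ φ → Flow G 1ℚ φ × y ≋ net φ
generatorFlow {n} G (inj₁ y≋0) =
  flowPt (λ _ _ → 0ℚ) (e zero) (e zero) ,
  record { inner-nonNeg = λ _ _ _ → ℚ.≤-refl
         ; source-nonNeg = e-nonNeg zero ; sink-nonNeg = e-nonNeg zero
         ; source-total = Σ-e {suc n} zero ; sink-total = Σ-e {suc n} zero
         ; conservation = λ v →
             trans (divergence-edgeVal-zero G v) (sym (ℚ.+-inverseʳ (e zero v))) } ,
  λ v → trans (y≋0 v) (sym (ℚ.+-inverseʳ (e zero v)))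
generatorFlow G (inj₂ (i , j , _ , (c , 0≤c , root≋) , y≋root)) =
  flowPt c (e i) (e j) ,
  record { inner-nonNeg = 0≤c
         ; source-nonNeg = e-nonNeg i ; sink-nonNeg = e-nonNeg j
         ; source-total = Σ-e i ; sink-total = Σ-e j
         ; conservation = λ v → trans (sym (fmap≡divergence G c v)) (sym (root≋ v)) } ,
  y≋root

pointSum⇒Flow : ∀ {n} (G : Graph (suc n)) ws →
  All (λ w → (0ℚ ≤ proj₁ w) × RootPolyGens G (proj₂ w)) ws →
  Σ (FlowPt (suc n)) λ φ → Flow G (weightSum ws) φ × pointSum ws ≋ net φ
pointSum⇒Flow G [] [] = zeroFlow , Flow-zero G , λ _ → sym (ℚ.+-inverseʳ 0ℚ)
pointSum⇒Flow G ((c , p) ∷ ws) ((0≤c , gen) ∷ ok) with generatorFlow G gen | pointSum⇒Flow G ws ok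
... | φ , F , p≋ | ψ , F' , ws≋ =
  scaleAdd c φ ψ ,
  subst (λ T → Flow G T (scaleAdd c φ ψ)) (cong (_+ weightSum ws) (ℚ.*-identityʳ c))
        (Flow-scaleAdd c 0≤c F F') ,
  λ v → trans (cong₂ (λ a b → c * a + b) (p≋ v) (ws≋ v)) (sym (net-scaleAdd c φ ψ v))

RootPolytope⇒Flow : ∀ {n} (G : Graph (suc n)) {y} → RootPolytope G y →
  Σ (FlowPt (suc n)) λ φ → FlowPolytope G φ × y ≋ fmap G (proj φ)
RootPolytope⇒Flow G (ws , ok , total , y≋) with pointSum⇒Flow G ws ok
... | φ , F , ws≋ =
  φ , Flow⇒FlowPolytope (subst (λ T → Flow G T φ) total F) ,
  λ v → trans (y≋ v) (trans (ws≋ v) (sym (fmap≋net F v)))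

-- f(p(F_G̃)) ⊆ P(G): rerouting a flow through its vertices

fmap-linear : ∀ {m} (G : Graph m) c (x y : W m) v →
  fmap G (λ a b → c * x a b + y a b) v ≡ c * fmap G x v + fmap G y v
fmap-linear G c x y v = begin
    fmap G (λ a b → c * x a b + y a b) v
  ≡⟨ fmap≡divergence G (λ a b → c * x a b + y a b) v ⟩
    divergence (edgeVal G (λ a b → c * x a b + y a b)) v
  ≡⟨ divergence-cong (edgeVal-linear G c x y) v ⟩
    divergence (λ a b → c * edgeVal G x a b + edgeVal G y a b) v
  ≡⟨ divergence-linear c (edgeVal G x) (edgeVal G y) v ⟩
    c * divergence (edgeVal G x) v + divergence (edgeVal G y) v
  ≡⟨ sym (cong₂ (λ a b → c * a + b) (fmap≡divergence G x v) (fmap≡divergence G y v)) ⟩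
    c * fmap G x v + fmap G y v ∎
  where open ≡-Reasoning

Cone-root-trans : ∀ {m} (G : Graph m) {i j k} →
  Cone G (root i j) → Cone G (root j k) → Cone G (root i k)
Cone-root-trans G {i} {j} {k} (c , 0≤c , ij≋) (c' , 0≤c' , jk≋) =
  (λ a b → 1ℚ * c a b + c' a b) ,
  (λ a b ab → nonNeg-+ (nonNeg-* 0≤1 (0≤c a b ab)) (0≤c' a b ab)) ,
  λ v → begin
    root i k v
  ≡⟨ solve 3 (λ x y z → x :- z := con 1ℚ :* (x :- y) :+ (y :- z)) refl (e i v) (e j v) (e k v) ⟩
    1ℚ * root i j v + root j k v
  ≡⟨ cong₂ (λ a b → 1ℚ * a + b) (ij≋ v) (jk≋ v) ⟩
    1ℚ * fmap G c v + fmap G c' v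
  ≡⟨ sym (fmap-linear G 1ℚ c c' v) ⟩
    fmap G (λ a b → 1ℚ * c a b + c' a b) v ∎
  where open ≡-Reasoning

edge⇒Cone : ∀ {m} (G : Graph m) {i j} → IsEdge G i j → Cone G (root i j)
edge⇒Cone {m} G {i} {j} ij = c , (λ a b _ → nonNeg-* (e-nonNeg i a) (e-nonNeg j b)) , λ v →
  sym (trans (fmap≡divergence G c v) (cong₂ _-_ (outflow≡ v) (inflow≡ v)))
  where
  c : W m
  c a b = e i a * e j b
  off : ∀ a b → Dec (i ≡ a) → Dec (j ≡ b) → ¬ IsEdge G a b → 0ℚ ≡ e i a * e j b
  off a b (yes refl) (yes refl) ¬ab = ⊥-elim (¬ab ij)
  off a b (no i≢a) _ _ = sym (trans (cong (_* e j b) (e-offDiag i≢a)) (ℚ.*-zeroˡ (e j b)))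
  off a b (yes _) (no j≢b) _ = sym (trans (cong (e i a *_) (e-offDiag j≢b)) (ℚ.*-zeroʳ (e i a)))
  edgeVal≡c : ∀ a b → edgeVal G c a b ≡ c a b
  edgeVal≡c a b with edgeB G a b in eq
  ... | true = refl
  ... | false = off a b (i Fin.≟ a) (j Fin.≟ b) (λ ab → subst T eq ab)
  outflow≡ : ∀ v → outflow (edgeVal G c) v ≡ e i v
  outflow≡ v = trans (Σ-cong m (edgeVal≡c v))
    (trans (Σ-distribˡ-* m (e i v) (e j)) (trans (cong (e i v *_) (Σ-e j)) (ℚ.*-identityʳ (e i v))))
  inflow≡ : ∀ v → inflow (edgeVal G c) v ≡ e j v
  inflow≡ v = trans (Σ-cong m (λ a → trans (edgeVal≡c a v) (ℚ.*-comm (e i a) (e j v))))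
    (trans (Σ-distribˡ-* m (e j v) (e i)) (trans (cong (e j v *_) (Σ-e i)) (ℚ.*-identityʳ (e j v))))

edge⇒< : ∀ {m} (G : Graph m) {i j} → IsEdge G i j → i <ᶠ j
edge⇒< G {i} {j} = from-does (i Fin.<? j)
  where
  from-does : (i<?j : Dec (i <ᶠ j)) → T (does i<?j ∧ G i j) → i <ᶠ j
  from-does (yes i<j) _ = i<j

ConeRoot : ∀ {m} → Graph m → Fin m → Fin m → Set
ConeRoot G i j = i <ᶠ j × Cone G (root i j)

Settled : ∀ {m} → Mat m → Fin m → Set
Settled M v = inflow M v ≡ 0ℚ ⊎ outflow M v ≡ 0ℚ

record Routing {m : ℕ} (G : Graph m) (φ : FlowPt m) (done : List (Fin m)) (M : Mat m) : Set where
  field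
    nonNeg    : ∀ i j → 0ℚ ≤ M i j
    supported : ∀ i j → M i j ≡ 0ℚ ⊎ ConeRoot G i j
    balanced  : ∀ v → divergence M v ≡ net φ v
    settled   : All (Settled M) done
open Routing

Routing-diag : ∀ {m} {G : Graph m} {φ ks M} → Routing G φ ks M → ∀ k → M k k ≡ 0ℚ
Routing-diag R k with supported R k k
... | inj₁ Mkk≡0 = Mkk≡0
... | inj₂ (k<k , _) = ⊥-elim (Fin.<-irrefl refl k<k)

initialRouting : ∀ {m} {G : Graph m} {T φ} → Flow G T φ → Routing G φ [] (edgeVal G (inner φ))
initialRouting {G = G} {φ = φ} F = record
  { nonNeg = edgeVal-nonNeg
  ; supported = edgeVal-supported
  ; balanced = conservation F
  ; settled = [] }
  where
  edgeVal-nonNeg : ∀ i j → 0ℚ ≤ edgeVal G (inner φ) i j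
  edgeVal-nonNeg i j with edgeB G i j in eq
  ... | true = inner-nonNeg F i j (subst T (sym eq) _)
  ... | false = ℚ.≤-refl
  edgeVal-supported : ∀ i j → edgeVal G (inner φ) i j ≡ 0ℚ ⊎ ConeRoot G i j
  edgeVal-supported i j with edgeB G i j in eq
  ... | true = inj₂ (edge⇒< G (subst T (sym eq) _) , edge⇒Cone G (subst T (sym eq) _))
  ... | false = inj₁ refl

saturatingRatio : ∀ {I O} → 0ℚ ≤ I → I ≤ O →
  Σ ℚ λ r → 0ℚ ≤ r × r * I ≤ 1ℚ × r * O ≤ 1ℚ × r * I * O ≡ I
saturatingRatio {I} {O} 0≤I I≤O with O ℚ.≟ 0ℚ
... | yes O≡0 =
  0ℚ , ℚ.≤-refl , 0*≤1 I , 0*≤1 O ,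
  trans (solve 2 (λ I O → con 0ℚ :* I :* O := con 0ℚ) refl I O) (sym I≡0)
  where
  I≡0 : I ≡ 0ℚ
  I≡0 = ℚ.≤-antisym (subst (I ≤_) O≡0 I≤O) 0≤I
  0*≤1 : ∀ p → 0ℚ * p ≤ 1ℚ
  0*≤1 p = subst (_≤ 1ℚ) (sym (ℚ.*-zeroˡ p)) 0≤1
... | no O≢0 =
  1/ O , ℚ.nonNegative⁻¹ (1/ O) ,
  ℚ.≤-trans (ℚ.*-monoˡ-≤-nonNeg (1/ O) I≤O) (ℚ.≤-reflexive 1/O*O≡1) , ℚ.≤-reflexive 1/O*O≡1 ,
  trans (solve 3 (λ r I O → r :* I :* O := I :* (r :* O)) refl (1/ O) I O)
        (trans (cong (I *_) 1/O*O≡1) (ℚ.*-identityʳ I))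
  where
  instance
    O-positive : Positive O
    O-positive = ℚ.nonNeg∧nonZero⇒pos O {{nonNegative (ℚ.≤-trans 0≤I I≤O)}} {{≢-nonZero O≢0}}
    O-nonZero : NonZero O
    O-nonZero = ℚ.pos⇒nonZero O
    1/O-nonNeg : NonNegative (1/ O)
    1/O-nonNeg = ℚ.pos⇒nonNeg (1/ O) {{ℚ.1/pos⇒pos O}}
  1/O*O≡1 : 1/ O * O ≡ 1ℚ
  1/O*O≡1 = ℚ.*-inverseˡ O

reroutingRatio : ∀ {I O} → 0ℚ ≤ I → 0ℚ ≤ O →
  Σ ℚ λ r → 0ℚ ≤ r × r * I ≤ 1ℚ × r * O ≤ 1ℚ × (r * I * O ≡ I ⊎ r * I * O ≡ O)
reroutingRatio {I} {O} 0≤I 0≤O with ℚ.≤-total I O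
... | inj₁ I≤O with saturatingRatio 0≤I I≤O
...   | r , 0≤r , rI≤1 , rO≤1 , sat = r , 0≤r , rI≤1 , rO≤1 , inj₁ sat
reroutingRatio {I} {O} 0≤I 0≤O | inj₂ O≤I with saturatingRatio 0≤O O≤I
... | r , 0≤r , rO≤1 , rI≤1 , sat =
  r , 0≤r , rI≤1 , rO≤1 , inj₂ (trans (solve 3 (λ r I O → r :* I :* O := r :* O :* I) refl r I O) sat)

Σ-linear₃ : ∀ k (a b c : ℚ) (f g h q : Fin k → ℚ) →
  Σ[ k ] (λ i → a * f i + (b * g i + (c * h i + q i)))
    ≡ a * Σ[ k ] f + (b * Σ[ k ] g + (c * Σ[ k ] h + Σ[ k ] q))
Σ-linear₃ k a b c f g h q =
  trans (Σ-linear k a f _) (cong (a * Σ[ k ] f +_)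
    (trans (Σ-linear k b g _) (cong (b * Σ[ k ] g +_) (Σ-linear k c h q))))

-∙e-offDiag : ∀ {m} {v k : Fin m} a b → v ≢ k → a - e v k * b ≡ a
-∙e-offDiag a b v≢k =
  trans (cong (λ z → a - z * b) (e-offDiag v≢k)) (solve 2 (λ a b → a :- con 0ℚ :* b := a) refl a b)

-∙e-diag : ∀ {m} (k : Fin m) a b → a - e k k * b ≡ a - b
-∙e-diag k a b =
  trans (cong (λ z → a - z * b) (e-diag k)) (solve 2 (λ a b → a :- con 1ℚ :* b := a :- b) refl a b)

-- Each path i → k → j hands r · M i k · M k j over to the pair (i, j);
-- the entries at k shrink by exactly the amount handed over.
module Reroute {m : ℕ} (M : Mat m) (k : Fin m) (r : ℚ) where

  I O : ℚ
  I = inflow M k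
  O = outflow M k

  scaling : Fin m → Fin m → ℚ
  scaling i j = 1ℚ - e j k * (r * O) - e i k * (r * I)

  rerouted : Mat m
  rerouted i j = M i j * scaling i j + r * M i k * M k j

  outflow-rerouted : ∀ v → outflow rerouted v ≡ outflow M v - e v k * (r * I * outflow M v)
  outflow-rerouted v = begin
      outflow rerouted v
    ≡⟨ Σ-cong m (λ j → regroup (M v j) (e j k) (M v k) (M k j)) ⟩
      Σ[ m ] (λ j → α * M k j + (β * (e j k * M v j) + (γ * M v j + M v j)))
    ≡⟨ Σ-linear₃ m α β γ (M k) (λ j → e j k * M v j) (M v) (M v) ⟩
      α * O + (β * Σ[ m ] (λ j → e j k * M v j) + (γ * outflow M v + outflow M v))
    ≡⟨ cong (λ z → α * O + (β * z + (γ * outflow M v + outflow M v))) (Σ-e-* m k (M v)) ⟩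
      α * O + (β * M v k + (γ * outflow M v + outflow M v))
    ≡⟨ solve 6 (λ r O I y b x → r :* y :* O :+ (:- (r :* O) :* y :+ (:- (b :* (r :* I)) :* x :+ x))
                                := x :- b :* (r :* I :* x)) refl r O I (M v k) (e v k) (outflow M v) ⟩
      outflow M v - e v k * (r * I * outflow M v) ∎
    where
    open ≡-Reasoning
    α β γ : ℚ
    α = r * M v k
    β = - (r * O)
    γ = - (e v k * (r * I))
    regroup : ∀ x a y z → x * (1ℚ - a * (r * O) - e v k * (r * I)) + r * y * z
                        ≡ r * y * z + (- (r * O) * (a * x) + (- (e v k * (r * I)) * x + x))
    regroup x a y z =
      solve 8 (λ r O I b x a y z → x :* (con 1ℚ :- a :* (r :* O) :- b :* (r :* I)) :+ r :* y :* z
                 := r :* y :* z :+ (:- (r :* O) :* (a :* x) :+ (:- (b :* (r :* I)) :* x :+ x)))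
              refl r O I (e v k) x a y z

  inflow-rerouted : ∀ v → inflow rerouted v ≡ inflow M v - e v k * (r * O * inflow M v)
  inflow-rerouted v = begin
      inflow rerouted v
    ≡⟨ Σ-cong m (λ i → regroup (M i v) (e i k) (M i k) (M k v)) ⟩
      Σ[ m ] (λ i → α * M i k + (β * (e i k * M i v) + (γ * M i v + M i v)))
    ≡⟨ Σ-linear₃ m α β γ (λ i → M i k) (λ i → e i k * M i v) (λ i → M i v) (λ i → M i v) ⟩
      α * I + (β * Σ[ m ] (λ i → e i k * M i v) + (γ * inflow M v + inflow M v))
    ≡⟨ cong (λ z → α * I + (β * z + (γ * inflow M v + inflow M v))) (Σ-e-* m k (λ i → M i v)) ⟩
      α * I + (β * M k v + (γ * inflow M v + inflow M v))
    ≡⟨ solve 6 (λ r O I y b x → r :* y :* I :+ (:- (r :* I) :* y :+ (:- (b :* (r :* O)) :* x :+ x))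
                                := x :- b :* (r :* O :* x)) refl r O I (M k v) (e v k) (inflow M v) ⟩
      inflow M v - e v k * (r * O * inflow M v) ∎
    where
    open ≡-Reasoning
    α β γ : ℚ
    α = r * M k v
    β = - (r * I)
    γ = - (e v k * (r * O))
    regroup : ∀ x a y z → x * (1ℚ - e v k * (r * O) - a * (r * I)) + r * y * z
                        ≡ r * z * y + (- (r * I) * (a * x) + (- (e v k * (r * O)) * x + x))
    regroup x a y z =
      solve 8 (λ r O I b x a y z → x :* (con 1ℚ :- b :* (r :* O) :- a :* (r :* I)) :+ r :* y :* z
                 := r :* z :* y :+ (:- (r :* I) :* (a :* x) :+ (:- (b :* (r :* O)) :* x :+ x)))
              refl r O I (e v k) x a y z

  divergence-rerouted : ∀ v → divergence rerouted v ≡ divergence M v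
  divergence-rerouted v = begin
      divergence rerouted v
    ≡⟨ cong₂ _-_ (outflow-rerouted v) (trans (inflow-rerouted v) (cong (λ z → inflow M v - z) through-k)) ⟩
      (outflow M v - e v k * (r * I * outflow M v)) - (inflow M v - e v k * (r * I * outflow M v))
    ≡⟨ solve 3 (λ a b x → (a :- x) :- (b :- x) := a :- b) refl (outflow M v) (inflow M v) _ ⟩
      divergence M v ∎
    where
    open ≡-Reasoning
    vanish : ∀ x → v ≢ k → e v k * x ≡ 0ℚ
    vanish x v≢k = trans (cong (_* x) (e-offDiag v≢k)) (ℚ.*-zeroˡ x)
    through-k′ : Dec (v ≡ k) → e v k * (r * O * inflow M v) ≡ e v k * (r * I * outflow M v)
    through-k′ (yes refl) = cong (e k k *_) (solve 3 (λ r I O → r :* O :* I := r :* I :* O) refl r I O)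
    through-k′ (no v≢k) = trans (vanish _ v≢k) (sym (vanish _ v≢k))
    through-k : e v k * (r * O * inflow M v) ≡ e v k * (r * I * outflow M v)
    through-k = through-k′ (v Fin.≟ k)

  flows-rerouted-away : ∀ {v} → v ≢ k →
    inflow rerouted v ≡ inflow M v × outflow rerouted v ≡ outflow M v
  flows-rerouted-away v≢k = trans (inflow-rerouted _) (-∙e-offDiag _ _ v≢k) ,
                            trans (outflow-rerouted _) (-∙e-offDiag _ _ v≢k)

  flows-rerouted-at : inflow rerouted k ≡ I - r * I * O × outflow rerouted k ≡ O - r * I * O
  flows-rerouted-at =
    trans (inflow-rerouted k) (trans (-∙e-diag k I _)
          (cong (λ z → I - z) (solve 3 (λ r I O → r :* O :* I := r :* I :* O) refl r I O))) ,
    trans (outflow-rerouted k) (-∙e-diag k O _)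

module RerouteStep {m : ℕ} {G : Graph m} {φ ks M} (R : Routing G φ ks M) (k : Fin m) {r : ℚ}
  (0≤r : 0ℚ ≤ r) (rI≤1 : r * inflow M k ≤ 1ℚ) (rO≤1 : r * outflow M k ≤ 1ℚ)
  (saturated : r * inflow M k * outflow M k ≡ inflow M k ⊎ r * inflow M k * outflow M k ≡ outflow M k)
  where

  open Reroute M k r

  scaling≡ : ∀ i j {a b} → e j k ≡ a → e i k ≡ b → scaling i j ≡ 1ℚ - a * (r * O) - b * (r * I)
  scaling≡ i j eⱼ eᵢ = cong₂ (λ a b → 1ℚ - a * (r * O) - b * (r * I)) eⱼ eᵢ

  weighted-nonNeg : ∀ i j → Dec (i ≡ k) → Dec (j ≡ k) → 0ℚ ≤ M i j * scaling i j
  weighted-nonNeg i j (yes refl) (yes refl) =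
    ℚ.≤-reflexive (sym (trans (cong (_* scaling k k) (Routing-diag R k)) (ℚ.*-zeroˡ (scaling k k))))
  weighted-nonNeg i j (yes refl) (no j≢k) = nonNeg-* (nonNeg R k j) (subst (0ℚ ≤_)
    (sym (trans (scaling≡ k j (e-offDiag j≢k) (e-diag k))
                (solve 2 (λ x y → con 1ℚ :- con 0ℚ :* x :- con 1ℚ :* y := con 1ℚ :- y) refl (r * O) (r * I))))
    (p≤q⇒0≤q-p rI≤1))
  weighted-nonNeg i j (no i≢k) (yes refl) = nonNeg-* (nonNeg R i k) (subst (0ℚ ≤_)
    (sym (trans (scaling≡ i k (e-diag k) (e-offDiag i≢k))
                (solve 2 (λ x y → con 1ℚ :- con 1ℚ :* x :- con 0ℚ :* y := con 1ℚ :- x) refl (r * O) (r * I))))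
    (p≤q⇒0≤q-p rO≤1))
  weighted-nonNeg i j (no i≢k) (no j≢k) = nonNeg-* (nonNeg R i j) (subst (0ℚ ≤_)
    (sym (trans (scaling≡ i j (e-offDiag j≢k) (e-offDiag i≢k))
                (solve 2 (λ x y → con 1ℚ :- con 0ℚ :* x :- con 0ℚ :* y := con 1ℚ) refl (r * O) (r * I))))
    0≤1)

  rerouted-nonNeg : ∀ i j → 0ℚ ≤ rerouted i j
  rerouted-nonNeg i j = nonNeg-+ (weighted-nonNeg i j (i Fin.≟ k) (j Fin.≟ k))
                                 (nonNeg-* (nonNeg-* 0≤r (nonNeg R i k)) (nonNeg R k j))

  rerouted-supported : ∀ i j → rerouted i j ≡ 0ℚ ⊎ ConeRoot G i j
  rerouted-supported i j with supported R i j | supported R i k | supported R k j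
  ... | inj₂ ij | _ | _ = inj₂ ij
  ... | inj₁ Mij≡0 | inj₁ Mik≡0 | _ =
    inj₁ (trans (cong₂ (λ a b → a * scaling i j + r * b * M k j) Mij≡0 Mik≡0)
                (solve 3 (λ x y z → con 0ℚ :* x :+ y :* con 0ℚ :* z := con 0ℚ) refl (scaling i j) r (M k j)))
  ... | inj₁ Mij≡0 | inj₂ _ | inj₁ Mkj≡0 =
    inj₁ (trans (cong₂ (λ a b → a * scaling i j + r * M i k * b) Mij≡0 Mkj≡0)
                (solve 3 (λ x y z → con 0ℚ :* x :+ y :* z :* con 0ℚ := con 0ℚ) refl (scaling i j) r (M i k)))
  ... | inj₁ _ | inj₂ (i<k , ik) | inj₂ (k<j , kj) =
    inj₂ (Fin.<-trans i<k k<j , Cone-root-trans G {i} {k} {j} ik kj)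

  settled-k : Settled rerouted k
  settled-k = saturate saturated
    where
    saturate : r * I * O ≡ I ⊎ r * I * O ≡ O → Settled rerouted k
    saturate (inj₁ rIO≡I) =
      inj₁ (trans (proj₁ flows-rerouted-at) (trans (cong (λ z → I - z) rIO≡I) (ℚ.+-inverseʳ I)))
    saturate (inj₂ rIO≡O) =
      inj₂ (trans (proj₂ flows-rerouted-at) (trans (cong (λ z → O - z) rIO≡O) (ℚ.+-inverseʳ O)))

  settled-preserved : ∀ v → Dec (v ≡ k) → Settled M v → Settled rerouted v
  settled-preserved v (yes refl) _ = settled-k
  settled-preserved v (no v≢k) (inj₁ inflow≡0) = inj₁ (trans (proj₁ (flows-rerouted-away v≢k)) inflow≡0)
  settled-preserved v (no v≢k) (inj₂ outflow≡0) = inj₂ (trans (proj₂ (flows-rerouted-away v≢k)) outflow≡0)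

  routing : Routing G φ (k ∷ ks) rerouted
  routing = record
    { nonNeg = rerouted-nonNeg
    ; supported = rerouted-supported
    ; balanced = λ v → trans (divergence-rerouted v) (balanced R v)
    ; settled = settled-k ∷ All.map (λ {v} → settled-preserved v (v Fin.≟ k)) (settled R) }

reroute : ∀ {m} {G : Graph m} {φ ks M} → Routing G φ ks M → ∀ k → Σ (Mat m) (Routing G φ (k ∷ ks))
reroute {m} {M = M} R k with reroutingRatio (Σ-nonNeg m (λ i → nonNeg R i k)) (Σ-nonNeg m (nonNeg R k))
... | r , 0≤r , rI≤1 , rO≤1 , saturated =
  Reroute.rerouted M k r , RerouteStep.routing R k 0≤r rI≤1 rO≤1 saturated

settleAll : ∀ {m} {G : Graph m} {φ M} ks → Routing G φ [] M → Σ (Mat m) (Routing G φ ks)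
settleAll [] R = _ , R
settleAll (k ∷ ks) R = reroute (proj₂ (settleAll ks R)) k

outflow≤source : ∀ {m} {G : Graph m} {T φ ks M} → Flow G T φ → Routing G φ ks M →
  ∀ v → Settled M v → outflow M v ≤ source φ v
outflow≤source {φ = φ} {M = M} F R v (inj₁ inflow≡0) =
  0≤q-p⇒p≤q (subst (0ℚ ≤_) (sym source-outflow≡sink) (sink-nonNeg F v))
  where
  source-outflow≡sink : source φ v - outflow M v ≡ sink φ v
  source-outflow≡sink = begin
      source φ v - outflow M v
    ≡⟨ cong (λ z → source φ v - z) (sym (trans (cong (λ z → outflow M v - z) inflow≡0)
                                                (ℚ.+-identityʳ (outflow M v)))) ⟩
      source φ v - divergence M v
    ≡⟨ cong (λ z → source φ v - z) (balanced R v) ⟩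
      source φ v - (source φ v - sink φ v)
    ≡⟨ solve 2 (λ s t → s :- (s :- t) := t) refl (source φ v) (sink φ v) ⟩
      sink φ v ∎
    where open ≡-Reasoning
outflow≤source F R v (inj₂ outflow≡0) = subst (_≤ _) (sym outflow≡0) (source-nonNeg F v)

Combination-root : ∀ {m} {G : Graph m} {φ ks M} → Routing G φ ks M →
  ∀ a b → Combination (RootPolyGens G) (M a b) (M a b ⊙ root a b)
Combination-root {M = M} R a b with supported R a b
... | inj₁ Mab≡0 =
  Combination-cong (sym Mab≡0) (λ v → sym (trans (cong (_* root a b v) Mab≡0) (ℚ.*-zeroˡ (root a b v))))
                   Combination-zero
... | inj₂ (a<b , cone) = Combination-single (nonNeg R a b) (inj₂ (a , b , a<b , cone , λ _ → refl))

-- The leftover weight 1 - Σ M a b ≥ 0 is put on the generator 0.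
Routing⇒RootPolytope : ∀ {m} {G : Graph m} {φ M} → Flow G 1ℚ φ → Routing G φ (allFin m) M →
  RootPolytope G (net φ)
Routing⇒RootPolytope {m} {G} {φ} {M} F R = Combination-cong total≡1 point≋ (Combination-+ routed slack)
  where
  total : ℚ
  total = Σ[ m ] (outflow M)
  routed : Combination (RootPolyGens G) total (Σv[ m ] λ a → Σv[ m ] λ b → M a b ⊙ root a b)
  routed = Combination-Σ m (λ a → Combination-Σ m (Combination-root R a))
  total≤1 : total ≤ 1ℚ
  total≤1 = subst (total ≤_) (source-total F)
    (Σ-mono-≤ m (λ v → outflow≤source F R v (All.lookup (settled R) (∈-allFin v))))
  slack : Combination (RootPolyGens G) (1ℚ - total) ((1ℚ - total) ⊙ 0v)
  slack = Combination-single (p≤q⇒0≤q-p total≤1) (inj₁ (λ _ → refl))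
  total≡1 : total + (1ℚ - total) ≡ 1ℚ
  total≡1 = solve 1 (λ t → t :+ (con 1ℚ :- t) := con 1ℚ) refl total
  point≋ : ∀ v → Σ[ m ] (λ a → Σ[ m ] (λ b → M a b * root a b v)) + (1ℚ - total) * 0ℚ ≡ net φ v
  point≋ v = trans (cong₂ _+_ (Σ-*-root M v) (ℚ.*-zeroʳ (1ℚ - total)))
                   (trans (ℚ.+-identityʳ (divergence M v)) (balanced R v))

Flow⇒RootPolytope : ∀ {m} {G : Graph m} {φ} → Flow G 1ℚ φ → RootPolytope G (net φ)
Flow⇒RootPolytope {m} F = Routing⇒RootPolytope F (proj₂ (settleAll (allFin m) (initialRouting F)))

RootPolytope⇔flowImage : ∀ {n} (G : Graph (suc n)) (y : Pt (suc n)) →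
  RootPolytope G y ⇔ Σ (FlowPt (suc n)) (λ φ → FlowPolytope G φ × y ≋ fmap G (proj φ))
RootPolytope⇔flowImage G y = mk⇔ (RootPolytope⇒Flow G) from-flow
  where
  from-flow : Σ (FlowPt _) (λ φ → FlowPolytope G φ × y ≋ fmap G (proj φ)) → RootPolytope G y
  from-flow (φ , P , y≋) =
    Combination-cong refl (λ v → sym (trans (y≋ v) (fmap≋net F v))) (Flow⇒RootPolytope F)
    where
    F = FlowPolytope⇒Flow P

-- f is injective on W when G is acyclic

Unique-lookup-injective : ∀ {A : Set} {xs : List A} → Unique xs →
  ∀ {i j} → i <ᶠ j → lookup xs i ≢ lookup xs j
Unique-lookup-injective (x∉xs ∷ _) {zero} {suc j} _ = All.lookup x∉xs (∈-lookup j)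
Unique-lookup-injective (_ ∷ u) {suc i} {suc j} (ℕ.s≤s i<j) = Unique-lookup-injective u i<j

Unique⇒length≤ : ∀ {m} {xs : List (Fin m)} → Unique xs → ¬ (m ℕ.< length xs)
Unique⇒length≤ {xs = xs} u m<length with Fin.pigeonhole m<length (lookup xs)
... | i , j , i<j , same = Unique-lookup-injective u i<j same

All-truncate : ∀ {A : Set} {P : A → Set} zs {w : A} {ys} →
  All P (zs ++ w ∷ ys) → All P (zs ++ w ∷ [])
All-truncate [] (Pw ∷ _) = Pw ∷ []
All-truncate (z ∷ zs) (Pz ∷ Pzs) = Pz ∷ All-truncate zs Pzs

AllPairs-truncate : ∀ {A : Set} {R : A → A → Set} zs {w : A} {ys} →
  AllPairs R (zs ++ w ∷ ys) → AllPairs R (zs ++ w ∷ [])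
AllPairs-truncate [] (_ ∷ _) = [] ∷ []
AllPairs-truncate (z ∷ zs) (Rz ∷ Rzs) = All-truncate zs Rz ∷ AllPairs-truncate zs Rzs

Linked-truncate : ∀ {A : Set} {R : A → A → Set} zs {w : A} {ys} →
  Linked R (zs ++ w ∷ ys) → Linked R (zs ++ w ∷ [])
Linked-truncate [] _ = [-]
Linked-truncate (z ∷ []) (Rzw ∷ _) = Rzw ∷ [-]
Linked-truncate (z ∷ z' ∷ zs) (Rzz' ∷ l) = Rzz' ∷ Linked-truncate (z' ∷ zs) l

Linked-∷ʳ : ∀ {A : Set} {R : A → A → Set} zs {w u : A} →
  Linked R (zs ++ w ∷ []) → R w u → Linked R ((zs ++ w ∷ []) ∷ʳ u)
Linked-∷ʳ [] _ Rwu = Rwu ∷ [-]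
Linked-∷ʳ (z ∷ []) (Rzw ∷ _) Rwu = Rzw ∷ Rwu ∷ [-]
Linked-∷ʳ (z ∷ z' ∷ zs) (Rzz' ∷ l) Rwu = Rzz' ∷ Linked-∷ʳ (z' ∷ zs) l Rwu

-- Along an edge carrying flow one can walk on forever without backtracking, since by
-- conservation every vertex reached has a second such edge; in a forest this never revisits a vertex.
module Circulation {m : ℕ} {G : Graph m} (acyclic : Acyclic G) (d : Mat m)
  (on-edges : ∀ a b → d a b ≢ 0ℚ → IsEdge G a b) (divergence-free : ∀ v → divergence d v ≡ 0ℚ)
  where

  Support : Fin m → Fin m → Set
  Support a b = d a b ≢ 0ℚ ⊎ d b a ≢ 0ℚ

  Support-sym : ∀ {a b} → Support a b → Support b a
  Support-sym (inj₁ dab≢0) = inj₂ dab≢0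
  Support-sym (inj₂ dba≢0) = inj₁ dba≢0

  Support⇒Adj : ∀ {a b} → Support a b → Adj G a b
  Support⇒Adj {a} {b} (inj₁ dab≢0) = inj₁ (on-edges a b dab≢0)
  Support⇒Adj {a} {b} (inj₂ dba≢0) = inj₂ (on-edges b a dba≢0)

  Support-irrefl : ∀ {a b} → Support a b → a ≢ b
  Support-irrefl {a} (inj₁ daa≢0) refl = Fin.<-irrefl refl (edge⇒< G (on-edges a a daa≢0))
  Support-irrefl {a} (inj₂ daa≢0) refl = Fin.<-irrefl refl (edge⇒< G (on-edges a a daa≢0))

  Support? : ∀ a b → Dec (Support a b)
  Support? a b = ¬? (d a b ℚ.≟ 0ℚ) ⊎-dec ¬? (d b a ℚ.≟ 0ℚ)

  nonZero⇒reverse-zero : ∀ a b → d a b ≢ 0ℚ → d b a ≡ 0ℚ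
  nonZero⇒reverse-zero a b dab≢0 = decidable-stable (d b a ℚ.≟ 0ℚ) λ dba≢0 →
    Fin.<-asym (edge⇒< G (on-edges a b dab≢0)) (edge⇒< G (on-edges b a dba≢0))

  another-neighbour : ∀ {v p} → Support v p → Σ (Fin m) λ w → w ≢ p × Support v w
  another-neighbour {v} {p} vp with Fin.any? (λ w → ¬? (w Fin.≟ p) ×-dec Support? v w)
  ... | yes found = found
  ... | no none = ⊥-elim (only-neighbour vp)
    where
    zero-away : ∀ w → w ≢ p → d v w ≡ 0ℚ × d w v ≡ 0ℚ
    zero-away w w≢p = decidable-stable (d v w ℚ.≟ 0ℚ) (λ dvw≢0 → none (w , w≢p , inj₁ dvw≢0)) ,
                      decidable-stable (d w v ℚ.≟ 0ℚ) (λ dwv≢0 → none (w , w≢p , inj₂ dwv≢0))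
    dvp≡dpv : d v p ≡ d p v
    dvp≡dpv = begin
      d v p         ≡⟨ sym (Σ-single m (d v) p (λ w w≢p → proj₁ (zero-away w w≢p))) ⟩
      outflow d v   ≡⟨ p-q≡0⇒p≡q _ _ (divergence-free v) ⟩
      inflow d v    ≡⟨ Σ-single m (λ w → d w v) p (λ w w≢p → proj₂ (zero-away w w≢p)) ⟩
      d p v         ∎
      where open ≡-Reasoning
    only-neighbour : ¬ Support v p
    only-neighbour (inj₁ dvp≢0) = dvp≢0 (trans dvp≡dpv (nonZero⇒reverse-zero v p dvp≢0))
    only-neighbour (inj₂ dpv≢0) = dpv≢0 (trans (sym dvp≡dpv) (nonZero⇒reverse-zero p v dpv≢0))

  closeCycle : ∀ v p xs w → Unique (v ∷ p ∷ xs ++ w ∷ []) →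
    Linked Support ((v ∷ p ∷ xs ++ w ∷ []) ∷ʳ v) → ⊥
  closeCycle v p [] w u l = acyclic (v , p , w , [] , u , Linked.map Support⇒Adj l)
  closeCycle v p (x ∷ xs) w u l = acyclic (v , p , x , xs ++ w ∷ [] , u , Linked.map Support⇒Adj l)

  -- the walk is kept latest vertex first
  walk : ∀ fuel v p rest → Unique (v ∷ p ∷ rest) → Linked Support (v ∷ p ∷ rest) →
         m ℕ.< fuel ℕ.+ length (v ∷ p ∷ rest) → ⊥
  walk zero v p rest u _ long = Unique⇒length≤ u long
  walk (suc fuel) v p rest u l@(vp ∷ _) long with another-neighbour vp
  ... | w , w≢p , vw with Any.any? (w Fin.≟_) rest
  ...   | no w∉rest =
    walk fuel w v (p ∷ rest)
         (((λ w≡v → Support-irrefl vw (sym w≡v)) ∷ w≢p ∷ Allₚ.¬Any⇒All¬ rest w∉rest) ∷ u)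
         (Support-sym vw ∷ l) (subst (m ℕ.<_) (sym (ℕ.+-suc fuel _)) long)
  ...   | yes w∈rest with ∈-∃++ w∈rest
  ...     | xs , ys , refl =
    closeCycle v p xs w (AllPairs-truncate (v ∷ p ∷ xs) u)
               (Linked-∷ʳ (v ∷ p ∷ xs) (Linked-truncate (v ∷ p ∷ xs) l) (Support-sym vw))

  vanishes : ∀ a b → d a b ≡ 0ℚ
  vanishes a b = decidable-stable (d a b ℚ.≟ 0ℚ) λ dab≢0 →
    walk m b a [] ((Support-irrefl (inj₂ dab≢0) ∷ []) ∷ [] ∷ []) (inj₂ dab≢0 ∷ [-]) (ℕ.m<m+n m ℕ.z<s)

if-true : ∀ {A : Set} (b : Bool) {x y : A} → T b → (if b then x else y) ≡ x
if-true true _ = refl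

if-false : ∀ {A : Set} (b : Bool) {x y : A} → ¬ T b → (if b then x else y) ≡ y
if-false true ¬T = ⊥-elim (¬T _)
if-false false _ = refl

fmap-injective : ∀ {m} {G : Graph m} → Acyclic G → (x x' : W m) →
  fmap G x ≋ fmap G x' → x ≈W[ G ] x'
fmap-injective {m} {G} acyclic x x' fx≋fx' i j ij = p-q≡0⇒p≡q (x i j) (x' i j) (begin
    x i j - x' i j
  ≡⟨ solve 2 (λ a b → a :- b := con (- 1ℚ) :* b :+ a) refl (x i j) (x' i j) ⟩
    - 1ℚ * x' i j + x i j
  ≡⟨ sym (cong₂ (λ a b → - 1ℚ * a + b) (if-true (edgeB G i j) ij) (if-true (edgeB G i j) ij)) ⟩
    d i j
  ≡⟨ Circulation.vanishes acyclic d on-edges divergence-free i j ⟩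
    0ℚ ∎)
  where
  open ≡-Reasoning
  d : Mat m
  d a b = - 1ℚ * edgeVal G x' a b + edgeVal G x a b
  on-edges : ∀ a b → d a b ≢ 0ℚ → IsEdge G a b
  on-edges a b dab≢0 = decidable-stable (T? (edgeB G a b)) λ ¬ab →
    dab≢0 (cong₂ (λ p q → - 1ℚ * p + q) (if-false (edgeB G a b) ¬ab) (if-false (edgeB G a b) ¬ab))
  divergence-free : ∀ v → divergence d v ≡ 0ℚ
  divergence-free v = begin
      divergence d v
    ≡⟨ divergence-linear (- 1ℚ) (edgeVal G x') (edgeVal G x) v ⟩
      - 1ℚ * divergence (edgeVal G x') v + divergence (edgeVal G x) v
    ≡⟨ sym (cong₂ (λ a b → - 1ℚ * a + b) (fmap≡divergence G x' v) (fmap≡divergence G x v)) ⟩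
      - 1ℚ * fmap G x' v + fmap G x v
    ≡⟨ cong (λ z → - 1ℚ * fmap G x' v + z) (fx≋fx' v) ⟩
      - 1ℚ * fmap G x' v + fmap G x' v
    ≡⟨ solve 1 (λ a → con (- 1ℚ) :* a :+ a := con 0ℚ) refl (fmap G x' v) ⟩
      0ℚ ∎

theorem4p4 : (n : ℕ) (G : Graph (suc n)) → Acyclic G →
    ((y : Pt (suc n)) →
        RootPolytope G y ⇔ Σ (FlowPt (suc n)) (λ φ → FlowPolytope G φ × y ≋ fmap G (proj φ)))
    × ((φ ψ : FlowPt (suc n)) → FlowPolytope G φ → FlowPolytope G ψ →
        fmap G (proj φ) ≋ fmap G (proj ψ) → proj φ ≈W[ G ] proj ψ)
    × ((H : Graph (suc n)) → Arises G H → (y : Pt (suc n)) →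
        RootPolytope H y ⇔ Σ (FlowPt (suc n)) (λ φ → FlowPolytope H φ × y ≋ fmap H (proj φ)))
theorem4p4 n G acyclic =
  RootPolytope⇔flowImage G ,
  (λ φ ψ _ _ → fmap-injective acyclic (proj φ) (proj ψ)) ,
  -- P(H) = f(p(F_H̃)) holds for every graph H, so how H arose is irrelevant.
  λ H _ → RootPolytope⇔flowImage H
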